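{- Let $K$ be a field, $G\le K^\times$ a multiplicative subgroup with $G\neq K^\times$ and $-1\in G$, $T:=G+1$, and $\mathcal{N}_G:=\{\bigcap_{i=1}^n a_i\cdot T: n\in\mathbb{N}, a_1,\dots,a_n\in K^\times\}$. With $U,V$ ranging over $\mathcal{N}_G$, the following are equivalent: (V6) for all $U$ there exists $V$ such that for all $x,y\in K$, if $xy\in V$ then $x\in U$ or $y\in U$; (V6)$'$ there exists $V$ such that for all $x,y\in K$, if $xy\in V$ then $x\in T$ or $y\in T$.
   Context: $G+1=\{g+1:g\in G\}$, $a\cdot X=\{ax:x\in X\}$. -}

module Defs where

open import Level using (Level; _⊔_; suc)
open import Algebra.Bundles using (CommutativeRing)
open import Data.Nat using (ℕ)
import Data.Nat as ℕ
open import Data.Fin using (Fin)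
open import Data.Product using (Σ; ∃; _×_; _,_)
open import Data.Sum using (_⊎_)
open import Relation.Nullary using (¬_)

record Field (c ℓ : Level) : Set (Level.suc (c ⊔ ℓ)) where
  field
    commutativeRing : CommutativeRing c ℓ
  open CommutativeRing commutativeRing public
  field
    0≉1     : ¬ (0# ≈ 1#)
    inverse : ∀ x → ¬ (x ≈ 0#) → ∃ λ y → x * y ≈ 1#

module _ {c ℓ : Level} (K : Field c ℓ) where
  open Field K

  record IsSubgroupOfUnits {g : Level} (G : Carrier → Set g) : Set (c ⊔ ℓ ⊔ g) where
    field
      respects : ∀ {x y} → x ≈ y → G x → G y
      nonzero  : ∀ {x} → G x → ¬ (x ≈ 0#)
      one      : G 1#
      mul      : ∀ {x y} → G x → G y → G (x * y)
      inv      : ∀ {x} → G x → ∃ λ y → G y × (x * y ≈ 1#)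

  module _ {g : Level} (G : Carrier → Set g) where

    T : Carrier → Set (c ⊔ ℓ ⊔ g)
    T t = ∃ λ h → G h × (t ≈ h + 1#)

    _·T : Carrier → Carrier → Set (c ⊔ ℓ ⊔ g)
    (a ·T) x = ∃ λ t → T t × (x ≈ a * t)

    -- An element of 𝒩_G: the data (n ≥ 1, a₁,…,aₙ ∈ K^×) of ⋂ᵢ aᵢ · T.
    record NSet : Set (c ⊔ ℓ) where
      field
        n  : ℕ
        a  : Fin (ℕ.suc n) → Carrier
        nz : ∀ i → ¬ (a i ≈ 0#)

    _∈N_ : Carrier → NSet → Set (c ⊔ ℓ ⊔ g)
    x ∈N U = ∀ i → (NSet.a U i ·T) x

    V6 : Set (c ⊔ ℓ ⊔ g)
    V6 = ∀ (U : NSet) → ∃ λ (V : NSet) →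
           ∀ x y → (x * y) ∈N V → (x ∈N U) ⊎ (y ∈N U)

    V6' : Set (c ⊔ ℓ ⊔ g)
    V6' = ∃ λ (V : NSet) → ∀ x y → (x * y) ∈N V → T x ⊎ T y

-- (V6) ⇒ (V6)' is the instance U = 1·T. For the converse, take V from (V6)' and U = ⋂ᵢ aᵢ·T,
-- and put V' := ⋂ᵢⱼₖ aᵢaⱼbₖ·T. If xy ∈ V' then, for every pair i, j, rescaling gives
-- (x/aᵢ)(y/aⱼ) ∈ V, so x ∈ aᵢ·T or y ∈ aⱼ·T; a choice that holds for all pairs (i, j) forces
-- x ∈ U or y ∈ U. None of the hypotheses on G is needed.
module Submission where

open import Defs
open import Level using (Level)
open import Data.Product using (∃; _×_; _,_; uncurry)
open import Data.Sum using (_⊎_; inj₁; inj₂; swap)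
import Data.Sum as Sum
open import Data.Fin using (Fin; zero; suc; combine; remQuot)
open import Data.Fin.Properties using (remQuot-combine)
import Data.Nat as ℕ
open import Relation.Nullary using (¬_)
open import Relation.Binary.PropositionalEquality using (_≡_; cong; subst)
open import Function.Bundles using (_⇔_; mk⇔)
import Algebra.Properties.CommutativeSemigroup as CommutativeSemigroupProperties
import Relation.Binary.Reasoning.Setoid as SetoidReasoning

⊎-∀-distribˡ : ∀ {a b k} {A : Set a} {Q : Fin k → Set b} →
               (∀ j → A ⊎ Q j) → A ⊎ (∀ j → Q j)
⊎-∀-distribˡ {k = ℕ.zero}  f = inj₂ λ ()
⊎-∀-distribˡ {k = ℕ.suc k} f with f zero | ⊎-∀-distribˡ (λ j → f (suc j))
... | inj₁ a | _       = inj₁ a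
... | inj₂ _ | inj₁ a  = inj₁ a
... | inj₂ q | inj₂ qs = inj₂ λ { zero → q ; (suc j) → qs j }

⊎-∀-distribʳ : ∀ {a b k} {P : Fin k → Set a} {B : Set b} →
               (∀ i → P i ⊎ B) → (∀ i → P i) ⊎ B
⊎-∀-distribʳ f = swap (⊎-∀-distribˡ (λ i → swap (f i)))

∀∀-⊎ : ∀ {a b m k} {P : Fin m → Set a} {Q : Fin k → Set b} →
       (∀ i j → P i ⊎ Q j) → (∀ i → P i) ⊎ (∀ j → Q j)
∀∀-⊎ f = ⊎-∀-distribʳ (λ i → ⊎-∀-distribˡ (f i))

module _ {c ℓ : Level} (K : Field c ℓ) where
  open Field K hiding (zero)
  open CommutativeSemigroupProperties *-commutativeSemigroup
    using (interchange; x∙yz≈y∙xz; xy∙z≈xz∙y)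
  open SetoidReasoning setoid

  x≉0∧y≉0⇒x*y≉0 : ∀ {x y} → ¬ (x ≈ 0#) → ¬ (y ≈ 0#) → ¬ (x * y ≈ 0#)
  x≉0∧y≉0⇒x*y≉0 {x} {y} x≉0 y≉0 xy≈0 with inverse x x≉0
  ... | u , xu≈1 = y≉0 (begin
    y             ≈⟨ *-identityˡ y ⟨
    1# * y        ≈⟨ *-congʳ xu≈1 ⟨
    (x * u) * y   ≈⟨ xy∙z≈xz∙y x u y ⟩
    (x * y) * u   ≈⟨ *-congʳ xy≈0 ⟩
    0# * u        ≈⟨ zeroˡ u ⟩
    0#            ∎)

  *-inverse : ∀ {x y u v} → x * u ≈ 1# → y * v ≈ 1# → (x * y) * (u * v) ≈ 1#
  *-inverse {x} {y} {u} {v} xu≈1 yv≈1 = begin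
    (x * y) * (u * v) ≈⟨ interchange x y u v ⟩
    (x * u) * (y * v) ≈⟨ *-cong xu≈1 yv≈1 ⟩
    1# * 1#           ≈⟨ *-identityˡ 1# ⟩
    1#                ∎

  module _ {g : Level} (G : Carrier → Set g) where

    ·T-resp-≈ : ∀ {a x y} → x ≈ y → (_·T K G a) x → (_·T K G a) y
    ·T-resp-≈ x≈y (t , Tt , x≈at) = t , Tt , trans (sym x≈y) x≈at

    ·T-intro : ∀ {a u x} → a * u ≈ 1# → T K G (x * u) → (_·T K G a) x
    ·T-intro {a} {u} {x} au≈1 Txu = x * u , Txu , (begin
      x           ≈⟨ *-identityʳ x ⟨
      x * 1#      ≈⟨ *-congˡ au≈1 ⟨
      x * (a * u) ≈⟨ x∙yz≈y∙xz x a u ⟩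
      a * (x * u) ∎)

    ·T-cancel : ∀ {a b u z} → a * u ≈ 1# → (_·T K G (a * b)) z → (_·T K G b) (z * u)
    ·T-cancel {a} {b} {u} {z} au≈1 (t , Tt , z≈abt) = t , Tt , (begin
      z * u             ≈⟨ *-congʳ z≈abt ⟩
      ((a * b) * t) * u ≈⟨ *-congʳ (*-assoc a b t) ⟩
      (a * (b * t)) * u ≈⟨ xy∙z≈xz∙y a (b * t) u ⟩
      (a * u) * (b * t) ≈⟨ *-congʳ au≈1 ⟩
      1# * (b * t)      ≈⟨ *-identityˡ (b * t) ⟩
      b * t             ∎)

    1·T⇒T : ∀ {x} → (_·T K G 1#) x → T K G x
    1·T⇒T {x} (t , (h , Gh , t≈h+1) , x≈1t) = h , Gh , trans x≈1t (trans (*-identityˡ t) t≈h+1)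

    T-NSet : NSet K G
    T-NSet = record { n = ℕ.zero ; a = λ _ → 1# ; nz = λ _ 1≈0 → 0≉1 (sym 1≈0) }

    -- The index set of ⋂ᵢⱼ aᵢbⱼ·T is Fin (m * n), read through remQuot.
    _⊗_ : NSet K G → NSet K G → NSet K G
    U ⊗ W = record
      { n  = _
      ; a  = λ k → uncurry (λ i j → NSet.a U i * NSet.a W j) (remQuot (ℕ.suc (NSet.n W)) k)
      ; nz = λ k → uncurry (λ i j → x≉0∧y≉0⇒x*y≉0 (NSet.nz U i) (NSet.nz W j))
                           (remQuot (ℕ.suc (NSet.n W)) k)
      }

    ⊗-combine : ∀ U W i j → NSet.a (U ⊗ W) (combine i j) ≡ NSet.a U i * NSet.a W j
    ⊗-combine U W i j =
      cong (uncurry (λ i j → NSet.a U i * NSet.a W j)) (remQuot-combine i j)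

    ∈N-⊗ : ∀ {x} U W → _∈N_ K G x (U ⊗ W) →
           ∀ i j → (_·T K G (NSet.a U i * NSet.a W j)) x
    ∈N-⊗ {x} U W x∈U⊗W i j =
      subst (λ s → (_·T K G s) x) (⊗-combine U W i j) (x∈U⊗W (combine i j))

    V6⇒V6' : V6 K G → V6' K G
    V6⇒V6' v6 with v6 T-NSet
    ... | V , split = V , λ x y xy∈V →
      Sum.map (λ x∈T → 1·T⇒T (x∈T zero)) (λ y∈T → 1·T⇒T (y∈T zero)) (split x y xy∈V)

    V6'⇒V6 : V6' K G → V6 K G
    V6'⇒V6 (V , split) U = (U ⊗ U) ⊗ V , λ x y xy∈V' → ∀∀-⊎ (pair x y xy∈V')
      where
      a = NSet.a U
      b = NSet.a V

      pair : ∀ x y → _∈N_ K G (x * y) ((U ⊗ U) ⊗ V) →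
             ∀ i j → (_·T K G (a i)) x ⊎ (_·T K G (a j)) y
      pair x y xy∈V' i j with inverse (a i) (NSet.nz U i) | inverse (a j) (NSet.nz U j)
      ... | u , aᵢu≈1 | v , aⱼv≈1 =
        Sum.map (·T-intro aᵢu≈1) (·T-intro aⱼv≈1) (split (x * u) (y * v) scaled∈V)
        where
        scaled∈V : _∈N_ K G ((x * u) * (y * v)) V
        scaled∈V k = ·T-resp-≈ (interchange x y u v)
          (·T-cancel (*-inverse aᵢu≈1 aⱼv≈1)
            (subst (λ s → (_·T K G (s * b k)) (x * y)) (⊗-combine U U i j)
              (∈N-⊗ (U ⊗ U) V xy∈V' (combine i j) k)))

lemma4p8 : {c ℓ g : Level} (K : Field c ℓ) (G : Field.Carrier K → Set g) →
    IsSubgroupOfUnits K G →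
    (∃ λ x → ¬ (Field._≈_ K x (Field.0# K)) × ¬ G x) →
    G (Field.-_ K (Field.1# K)) →
    V6 K G ⇔ V6' K G
lemma4p8 K G _ _ _ = mk⇔ (V6⇒V6' K G) (V6'⇒V6 K G)
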